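{- Let $p$ be a prime and $d>1$ an integer prime to $p$, and let $D=\{d\}\subset\mathbb{N}$. Then $$\pi_p(D)=\min_{1\le a\le d-1}\tau_d(a).$$
   Context: For $x\in\mathbb{Q}$, $\langle x\rangle=x-\lfloor x\rfloor$. Let $\ell$ be the order of $p$ in $(\mathbb{Z}/d\mathbb{Z})^\times$, and for $1\le a\le d-1$ set $\tau_d(a)=\frac1\ell\sum_{i=0}^{\ell-1}\langle ap^i/d\rangle$. $\sigma_p(N)$ is the sum of base-$p$ digits of $N\ge0$. For $m\ge1$, $E_D(m)$ is the set of $u\in\{1,\dots,p^m-1\}$ with $ud\equiv0\pmod{p^m-1}$; $\sigma_p(D,m)=\min_{u\in E_D(m)}\sigma_p(u)$, and $\pi_p(D)=\frac{1}{p-1}\min_{m\ge1}\frac{\sigma_p(D,m)}{m}$. -}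

module Defs where

open import Data.Nat as ℕ using (ℕ; zero; suc; _+_; _*_; _∸_; _^_; _⊓_; _≤_; _<_)
open import Data.Nat.DivMod using (_/_; _%_)
open import Data.Nat.Divisibility using (_∣_; _∣?_)
open import Data.Integer using (+_)
open import Data.Rational as ℚ using (ℚ; 0ℚ; floor; _-_)
open import Data.List using (List; map; foldr; filter; upTo; sum)
open import Data.Product using (∃-syntax; _×_)
open import Relation.Binary.PropositionalEquality using (_≡_; _≢_)
open import Relation.Nullary using (¬_)

-- n // m : the rational n/m (junk value 0 when m = 0; never used at m = 0 below)
_//_ : ℕ → ℕ → ℚ
n // zero = 0ℚ
n // suc m = (+ n) ℚ./ suc m

⟨_⟩ : ℚ → ℚ
⟨ x ⟩ = x - (floor x ℚ./ 1)

-- sum of base-p digits of n (fuel-based; the fuel n suffices when p ≥ 2)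
digitSumAux : ℕ → ℕ → ℕ → ℕ
digitSumAux q zero n = 0
digitSumAux q (suc f) n = n % suc q + digitSumAux q f (n / suc q)

σ-digits : (p : ℕ) → ℕ → ℕ
σ-digits zero n = 0   -- junk (base 0 is never used)
σ-digits (suc q) n = digitSumAux q n n

IsOrder : (p d ℓ : ℕ) → Set
IsOrder p d ℓ = 1 ≤ ℓ × d ∣ (p ^ ℓ ∸ 1) × (∀ k → 1 ≤ k → k < ℓ → ¬ (d ∣ (p ^ k ∸ 1)))

Σ< : ℕ → (ℕ → ℚ) → ℚ
Σ< zero f = 0ℚ
Σ< (suc n) f = Σ< n f ℚ.+ f n

τ : (p d ℓ a : ℕ) → ℚ
τ p d ℓ a = (1 // ℓ) ℚ.* Σ< ℓ (λ i → ⟨ (a * p ^ i) // d ⟩)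

E : (p d m : ℕ) → List ℕ
E p d m = filter (λ u → (p ^ m ∸ 1) ∣? (u * d)) (map suc (upTo (p ^ m ∸ 1)))

-- σ_p(D,m) = min_{u ∈ E_D(m)} σ_p(u); the seed p^m - 1 is itself an element of E_D(m)
σ-D : (p d m : ℕ) → ℕ
σ-D p d m = foldr (λ u r → σ-digits p u ⊓ r) (σ-digits p (p ^ m ∸ 1)) (E p d m)

IsMinOf : (P : ℕ → Set) → (ℕ → ℚ) → ℚ → Set
IsMinOf P f v = (∃[ x ] (P x × f x ≡ v)) × (∀ x → P x → v ℚ.≤ f x)

IsπD : (p d : ℕ) → ℚ → Set
IsπD p d v = IsMinOf (λ m → 1 ≤ m) (λ m → (1 // (p ∸ 1)) ℚ.* (σ-D p d m // m)) v

IsMinτ : (p d ℓ : ℕ) → ℚ → Set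
IsMinτ p d ℓ v = IsMinOf (λ a → 1 ≤ a × a ≤ d ∸ 1) (τ p d ℓ) v

module Submission where

-- Write r_c(i) = c·p^i mod d and S(c,n) = Σ_{i<n} r_c(i), so τ_d(a) = S(a,ℓ)/(ℓd).
-- 1. Long division of c < d by d in base p: if c·p^m = u·d + c then
--    d·σ_p(u) = (p-1)·S(c,m), from the invariant
--    σ_p(⌊c p^n/d⌋)·d + r_c(n) = (p-1)·S(c,n) + c (induction on n).
-- 2. Every u ∈ E_D(m) has u·d = c·(p^m - 1) with 1 ≤ c ≤ d.  For c = d,
--    u = p^m - 1 has σ_p(u) = m(p-1); for c < d, step 1 and the periodicity
--    ℓ·S(c,m) = m·S(c,ℓ) apply.  Either way (p-1)·m·min_a S(a,ℓ) ≤ ℓd·σ_p(u).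
-- 3. For m = ℓ and a minimiser a⋆ of S(·,ℓ), u = a⋆(p^ℓ-1)/d ∈ E_D(ℓ) attains
--    the bound, so the minimum defining π_p(D) is attained and equals τ_d(a⋆).

open import Defs
open import Data.Nat using (ℕ; _<_)
open import Data.Nat.Primality using (Prime)
open import Data.Nat.Coprimality using (Coprime)
open import Data.Product using (∃-syntax; _×_)

open import Data.Nat as ℕ
  using (zero; suc; _+_; _*_; _∸_; _^_; _⊓_; _≤_; z≤n; s≤s; NonZero; >-nonZero; >-nonZero⁻¹; nonTrivial⇒n>1)
open import Data.Nat.Properties
open import Data.Nat.DivMod
  using (_/_; _%_; m≡m%n+[m/n]*n; [m+kn]%n≡m%n; m%n<n; m<n⇒m%n≡m; /-congʳ; m*n/n≡m; m/n<m;
         m<n⇒m/n≡0; +-distrib-/-∣ˡ; +-distrib-/-∣ʳ; m*n/m*o≡n/o; m/n/o≡m/[n*o])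
open import Data.Nat.Divisibility using (_∣_; _∣?_; divides)
open import Data.Nat.GCD using (gcd; gcd[m,n]≢0)
open import Data.Nat.Primality using (prime⇒nonTrivial)
open import Data.Nat.Tactic.RingSolver using (solve-∀)
open import Data.Integer as ℤ using (+_; -[1+_])
import Data.Integer.Properties as ℤP
import Data.Integer.Tactic.RingSolver as ℤSolver
open import Data.Rational as ℚ using (ℚ; mkℚ; ↥_; ↧_; toℚᵘ; floor)
import Data.Rational.Properties as ℚP
import Data.Rational.Unnormalised as ℚᵘ
import Data.Rational.Unnormalised.Properties as ℚᵘP
open import Data.List using (List; []; _∷_; foldr; map; upTo)
open import Data.List.Membership.Propositional using (_∈_)
open import Data.List.Membership.Propositional.Properties
  using (∈-filter⁺; ∈-filter⁻; ∈-map⁺; ∈-map⁻; ∈-upTo⁺; ∈-upTo⁻)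
open import Data.List.Relation.Unary.Any using (here; there)
import Data.List.Relation.Unary.All as All
open import Data.List.Extrema.Nat using (argmin; argmin-all; f[argmin]≤f[xs])
open import Data.Product using (_,_; proj₁; proj₂)
open import Data.Sum using (inj₁; inj₂; [_,_]′)
open import Data.Empty using (⊥-elim)
open import Relation.Binary.PropositionalEquality

toℚᵘ-// : ∀ n m → toℚᵘ (n // suc m) ℚᵘ.≃ ℚᵘ.mkℚᵘ (+ n) m
toℚᵘ-// n m = ℚP.toℚᵘ-fromℚᵘ (ℚᵘ.mkℚᵘ (+ n) m)

+*+ : ∀ m n → + m ℤ.* + n ≡ + (m * n)
+*+ m n = sym (ℤP.pos-* m n)

//-cong : ∀ a b x y → a * suc y ≡ b * suc x → a // suc x ≡ b // suc y
//-cong a b x y ay≡bx = ℚP.toℚᵘ-injective (begin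
  toℚᵘ (a // suc x)      ≈⟨ toℚᵘ-// a x ⟩
  ℚᵘ.mkℚᵘ (+ a) x        ≈⟨ ℚᵘ.*≡* (trans (+*+ a (suc y)) (trans (cong +_ ay≡bx) (sym (+*+ b (suc x))))) ⟩
  ℚᵘ.mkℚᵘ (+ b) y        ≈⟨ ℚᵘP.≃-sym (toℚᵘ-// b y) ⟩
  toℚᵘ (b // suc y)      ∎)
  where open ℚᵘP.≃-Reasoning

//-mono-≤ : ∀ a b x y → a * suc y ≤ b * suc x → a // suc x ℚ.≤ b // suc y
//-mono-≤ a b x y ay≤bx = ℚP.toℚᵘ-cancel-≤
  (ℚᵘP.≤-respˡ-≃ (ℚᵘP.≃-sym (toℚᵘ-// a x)) (ℚᵘP.≤-respʳ-≃ (ℚᵘP.≃-sym (toℚᵘ-// b y))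
    (ℚᵘ.*≤* (subst₂ ℤ._≤_ (sym (+*+ a (suc y))) (sym (+*+ b (suc x))) (ℤ.+≤+ ay≤bx)))))

//-+ : ∀ a b m → (a // suc m) ℚ.+ (b // suc m) ≡ (a + b) // suc m
//-+ a b m = ℚP.toℚᵘ-injective (begin
  toℚᵘ ((a // D) ℚ.+ (b // D))                 ≈⟨ ℚP.toℚᵘ-homo-+ (a // D) (b // D) ⟩
  toℚᵘ (a // D) ℚᵘ.+ toℚᵘ (b // D)              ≈⟨ ℚᵘP.+-cong (toℚᵘ-// a m) (toℚᵘ-// b m) ⟩
  ℚᵘ.mkℚᵘ (+ a) m ℚᵘ.+ ℚᵘ.mkℚᵘ (+ b) m          ≈⟨ ℚᵘ.*≡* cross ⟩
  ℚᵘ.mkℚᵘ (+ (a + b)) m                        ≈⟨ ℚᵘP.≃-sym (toℚᵘ-// (a + b) m) ⟩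
  toℚᵘ ((a + b) // D)                          ∎)
  where
  open ℚᵘP.≃-Reasoning
  D = suc m
  cross : (+ a ℤ.* + D ℤ.+ + b ℤ.* + D) ℤ.* + D ≡ + (a + b) ℤ.* + (D * D)
  cross = trans (cong₂ (λ x y → (x ℤ.+ y) ℤ.* + D) (+*+ a D) (+*+ b D))
    (trans (+*+ (a * D + b * D) D)
    (trans (cong +_ (distrib a b D)) (sym (+*+ (a + b) (D * D)))))
    where
    distrib : ∀ a b D → (a * D + b * D) * D ≡ (a + b) * (D * D)
    distrib = solve-∀

//-*-inverse : ∀ b x y → (1 // suc x) ℚ.* (b // suc y) ≡ b // (suc x * suc y)
//-*-inverse b x y = ℚP.toℚᵘ-injective (begin
  toℚᵘ ((1 // suc x) ℚ.* (b // suc y))          ≈⟨ ℚP.toℚᵘ-homo-* (1 // suc x) (b // suc y) ⟩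
  toℚᵘ (1 // suc x) ℚᵘ.* toℚᵘ (b // suc y)       ≈⟨ ℚᵘP.*-cong (toℚᵘ-// 1 x) (toℚᵘ-// b y) ⟩
  ℚᵘ.mkℚᵘ (+ 1) x ℚᵘ.* ℚᵘ.mkℚᵘ (+ b) y           ≈⟨ ℚᵘ.*≡* (cong (ℤ._* + (suc x * suc y)) (ℤP.*-identityˡ (+ b))) ⟩
  ℚᵘ.mkℚᵘ (+ b) (y + x * suc y)                ≈⟨ ℚᵘP.≃-sym (toℚᵘ-// b _) ⟩
  toℚᵘ (b // (suc x * suc y))                   ∎)
  where open ℚᵘP.≃-Reasoning

-- A non-negative fraction whose numerator and denominator are n/g and (1+m)/g
-- has floor ⌊n/(1+m)⌋, since cancelling g does not change the quotient.
floor-reduced : ∀ (x : ℚ) n m g → ↥ x ℤ.* + suc g ≡ + n → ↧ x ℤ.* + suc g ≡ + suc m →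
                floor x ≡ + (n / suc m)
floor-reduced (mkℚ (+ a) b _) n m g num den
  with refl ← ℤP.+-injective (trans (ℤP.pos-* a (suc g)) num)
  with refl ← suc-injective (ℤP.+-injective (trans (ℤP.pos-* (suc b) (suc g)) den)) =
  trans (ℤP.*-identityˡ (+ (a / suc b))) (cong +_ (sym (trans
    (cong₂ (λ u v → u / suc v) (*-comm a (suc g)) (cong (_∸ 1) (*-comm (suc b) (suc g))))
    (m*n/m*o≡n/o (suc g) a (suc b)))))
floor-reduced (mkℚ -[1+ a ] b _) n m g () den

floor-// : ∀ n m → floor (n // suc m) ≡ + (n / suc m)
floor-// n m = reduce (gcd n (suc m)) refl
  where
  reduce : ∀ g → gcd n (suc m) ≡ g → floor (n // suc m) ≡ + (n / suc m)
  reduce zero g≡0 = ⊥-elim (gcd[m,n]≢0 n (suc m) (inj₂ (λ ())) g≡0)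
  reduce (suc g) g≡ = floor-reduced (n // suc m) n m g
    (subst (λ h → ↥ (n // suc m) ℤ.* + h ≡ + n) g≡ (ℚP.↥-/ (+ n) (suc m)))
    (subst (λ h → ↧ (n // suc m) ℤ.* + h ≡ + suc m) g≡ (ℚP.↧-/ (+ n) (suc m)))

frac-// : ∀ n m → ⟨ n // suc m ⟩ ≡ (n % suc m) // suc m
frac-// n m = trans (cong (λ z → (n // D) ℚ.- (z ℚ./ 1)) (floor-// n m)) (ℚP.toℚᵘ-injective (begin
  toℚᵘ ((n // D) ℚ.- (+ k ℚ./ 1))                     ≈⟨ ℚP.toℚᵘ-homo-+ (n // D) (ℚ.- (+ k ℚ./ 1)) ⟩
  toℚᵘ (n // D) ℚᵘ.+ toℚᵘ (ℚ.- (+ k ℚ./ 1))            ≈⟨ ℚᵘP.+-cong (toℚᵘ-// n m) (ℚᵘP.≃-trans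
                                                          (ℚP.toℚᵘ-homo‿- (+ k ℚ./ 1))
                                                          (ℚᵘP.-‿cong (ℚP.toℚᵘ-fromℚᵘ (ℚᵘ.mkℚᵘ (+ k) 0)))) ⟩
  ℚᵘ.mkℚᵘ (+ n) m ℚᵘ.- ℚᵘ.mkℚᵘ (+ k) 0                 ≈⟨ ℚᵘ.*≡* cross ⟩
  ℚᵘ.mkℚᵘ (+ (n % D)) m                               ≈⟨ ℚᵘP.≃-sym (toℚᵘ-// (n % D) m) ⟩
  toℚᵘ ((n % D) // D)                                 ∎))
  where
  open ℚᵘP.≃-Reasoning
  D = suc m
  k = n / D
  n≡r+kD : + n ≡ + (n % D) ℤ.+ + k ℤ.* + D
  n≡r+kD = trans (cong +_ (m≡m%n+[m/n]*n n D))
    (trans (ℤP.pos-+ (n % D) (k * D)) (cong (ℤ._+_ (+ (n % D))) (ℤP.pos-* k D)))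
  cancel : ∀ r k D → ((r ℤ.+ k ℤ.* D) ℤ.* + 1 ℤ.+ (ℤ.- k) ℤ.* D) ℤ.* D ≡ r ℤ.* D
  cancel = ℤSolver.solve-∀
  cross : (+ n ℤ.* + 1 ℤ.+ (ℤ.- (+ k)) ℤ.* + D) ℤ.* + D ≡ + (n % D) ℤ.* + (D * 1)
  cross = trans (cong (λ z → (z ℤ.* + 1 ℤ.+ (ℤ.- (+ k)) ℤ.* + D) ℤ.* + D) n≡r+kD)
    (trans (cancel (+ (n % D)) (+ k) (+ D)) (cong (λ z → + (n % D) ℤ.* + z) (sym (*-identityʳ D))))

∑ : ℕ → (ℕ → ℕ) → ℕ
∑ zero f = 0
∑ (suc n) f = ∑ n f + f n

∑-cong : ∀ {f g} n → (∀ i → f i ≡ g i) → ∑ n f ≡ ∑ n g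
∑-cong zero f≡g = refl
∑-cong (suc n) f≡g = cong₂ _+_ (∑-cong n f≡g) (f≡g n)

∑-+ : ∀ f a b → ∑ (a + b) f ≡ ∑ a f + ∑ b (λ i → f (a + i))
∑-+ f a zero = trans (cong (λ n → ∑ n f) (+-identityʳ a)) (sym (+-identityʳ _))
∑-+ f a (suc b) = trans (cong (λ n → ∑ n f) (+-suc a b))
  (trans (cong (_+ f (a + b)) (∑-+ f a b)) (+-assoc (∑ a f) _ _))

∑-periodic : ∀ f m → (∀ i → f (m + i) ≡ f i) → ∀ k → ∑ (k * m) f ≡ k * ∑ m f
∑-periodic f m periodic zero = refl
∑-periodic f m periodic (suc k) = trans (∑-+ f m (k * m))
  (cong (_+_ (∑ m f)) (trans (∑-cong (k * m) periodic) (∑-periodic f m periodic k)))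

∑-≤ : ∀ f n c → (∀ i → f i ≤ c) → ∑ n f ≤ n * c
∑-≤ f zero c f≤c = z≤n
∑-≤ f (suc n) c f≤c = subst (∑ n f + f n ≤_) (+-comm (n * c) c) (+-mono-≤ (∑-≤ f n c f≤c) (f≤c n))

min-fold : (ℕ → ℕ) → ℕ → List ℕ → ℕ
min-fold f s L = foldr (λ u r → f u ⊓ r) s L

min-fold-≤ : ∀ f s L {x} → x ∈ L → min-fold f s L ≤ f x
min-fold-≤ f s (y ∷ L) (here refl) = m⊓n≤m (f y) _
min-fold-≤ f s (y ∷ L) (there x∈L) = ≤-trans (m⊓n≤n (f y) _) (min-fold-≤ f s L x∈L)

-- The fold selects one of its candidates, so it inherits any property they all have.
min-fold-all : ∀ (P : ℕ → Set) f s L → P s → (∀ {x} → x ∈ L → P (f x)) → P (min-fold f s L)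
min-fold-all P f s [] Ps Pf = Ps
min-fold-all P f s (y ∷ L) Ps Pf with ⊓-sel (f y) (min-fold f s L)
... | inj₁ ≡fy = subst P (sym ≡fy) (Pf (here refl))
... | inj₂ ≡rest = subst P (sym ≡rest) (min-fold-all P f s L Ps (λ x∈L → Pf (there x∈L)))

interval : ℕ → List ℕ
interval n = map suc (upTo n)

∈-interval⁺ : ∀ {n a} → 1 ≤ a → a ≤ n → a ∈ interval n
∈-interval⁺ {n} {suc a} _ a<n = ∈-map⁺ suc {xs = upTo n} (∈-upTo⁺ a<n)

∈-interval⁻ : ∀ {n a} → a ∈ interval n → 1 ≤ a × a ≤ n
∈-interval⁻ {n} a∈ with _ , i∈ , refl ← ∈-map⁻ suc {xs = upTo n} a∈ = s≤s z≤n , ∈-upTo⁻ i∈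

argmin-interval : (f : ℕ → ℕ) → ∀ n → 1 ≤ n →
                  ∃[ a ] ((1 ≤ a × a ≤ n) × (∀ b → 1 ≤ b → b ≤ n → f a ≤ f b))
argmin-interval f n 1≤n =
  argmin f 1 (interval n)
  , argmin-all f {xs = interval n} (≤-refl , 1≤n) (All.tabulate ∈-interval⁻)
  , λ b 1≤b b≤n → All.lookup (f[argmin]≤f[xs] 1 (interval n)) (∈-interval⁺ 1≤b b≤n)

E-member : ∀ {p d m u} → u ∈ E p d m → (1 ≤ u × u ≤ p ^ m ∸ 1) × (p ^ m ∸ 1) ∣ u * d
E-member {p} {d} {m} u∈E with u∈ , ∣ud ← ∈-filter⁻ (λ u → (p ^ m ∸ 1) ∣? (u * d)) {xs = interval (p ^ m ∸ 1)} u∈E =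
  ∈-interval⁻ u∈ , ∣ud

E-cofactor : ∀ {p d m u} .{{_ : NonZero d}} → u ∈ E p d m →
             ∃[ c ] ((1 ≤ c × c ≤ d) × u * d ≡ c * (p ^ m ∸ 1))
E-cofactor {p} {d} {m} {u} u∈E with E-member {p} {d} {m} u∈E
... | (1≤u , u≤P) , divides zero ud≡0 = ⊥-elim (<⇒≱ (*-mono-≤ 1≤u (>-nonZero⁻¹ d)) (≤-reflexive ud≡0))
... | (1≤u , u≤P) , divides c@(suc _) ud≡cP = c , (s≤s z≤n , c≤d) , ud≡cP
  where
  P = p ^ m ∸ 1
  instance _ = >-nonZero (≤-trans 1≤u u≤P)
  c≤d : c ≤ d
  c≤d = *-cancelʳ-≤ c d P (begin
    c * P   ≡⟨ sym ud≡cP ⟩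
    u * d   ≤⟨ *-monoˡ-≤ d u≤P ⟩
    P * d   ≡⟨ *-comm P d ⟩
    d * P   ∎)
    where open ≤-Reasoning

E-intro : ∀ {p d m u} → 1 ≤ u → u ≤ p ^ m ∸ 1 → (p ^ m ∸ 1) ∣ u * d → u ∈ E p d m
E-intro {p} {d} {m} 1≤u u≤P ∣ud =
  ∈-filter⁺ (λ u → (p ^ m ∸ 1) ∣? (u * d)) (∈-interval⁺ 1≤u u≤P) ∣ud

module BaseExpansion (q : ℕ) where

  p : ℕ
  p = suc (suc q)

  σ : ℕ → ℕ
  σ = σ-digits p

  digitSumAux-0 : ∀ f → digitSumAux (suc q) f 0 ≡ 0
  digitSumAux-0 zero = refl
  digitSumAux-0 (suc f) = digitSumAux-0 f

  [1+n]/p≤n : ∀ n → suc n / p ≤ n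
  [1+n]/p≤n n = ℕ.≤-pred (m/n<m (suc n) p (s≤s (s≤s z≤n)))

  digitSumAux-fuel : ∀ f g n → n ≤ f → n ≤ g → digitSumAux (suc q) f n ≡ digitSumAux (suc q) g n
  digitSumAux-fuel f g zero _ _ = trans (digitSumAux-0 f) (sym (digitSumAux-0 g))
  digitSumAux-fuel (suc f) (suc g) (suc n) (s≤s n≤f) (s≤s n≤g) =
    cong (_+_ (suc n % p)) (digitSumAux-fuel f g (suc n / p) (≤-trans ([1+n]/p≤n n) n≤f) (≤-trans ([1+n]/p≤n n) n≤g))

  σ-step : ∀ n → σ n ≡ n % p + σ (n / p)
  σ-step zero = refl
  σ-step (suc n) = cong (_+_ (suc n % p)) (digitSumAux-fuel n (suc n / p) (suc n / p) ([1+n]/p≤n n) ≤-refl)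

  σ-digit : ∀ a b → a < p → σ (a + b * p) ≡ a + σ b
  σ-digit a b a<p = begin
    σ (a + b * p)                             ≡⟨ σ-step (a + b * p) ⟩
    (a + b * p) % p + σ ((a + b * p) / p)      ≡⟨ cong₂ (λ x y → x + σ y) last-digit leading-digits ⟩
    a + σ b                                   ∎
    where
    open ≡-Reasoning
    last-digit : (a + b * p) % p ≡ a
    last-digit = trans ([m+kn]%n≡m%n a b p) (m<n⇒m%n≡m a<p)
    leading-digits : (a + b * p) / p ≡ b
    leading-digits = trans (+-distrib-/-∣ʳ a (divides b refl)) (cong₂ _+_ (m<n⇒m/n≡0 a<p) (m*n/n≡m b p))

  -- p^m is positive.
  p^m≡1+[p^m∸1] : ∀ m → p ^ m ≡ suc (p ^ m ∸ 1)
  p^m≡1+[p^m∸1] m = sym (trans (+-comm 1 _) (m∸n+n≡m (m^n>0 p m)))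

  -- In base p, p^(m+1) - 1 is the digit p-1 followed by the digits of p^m - 1.
  p^[1+m]∸1 : ∀ m → p ^ suc m ∸ 1 ≡ suc q + (p ^ m ∸ 1) * p
  p^[1+m]∸1 m = trans (cong (λ x → p * x ∸ 1) (p^m≡1+[p^m∸1] m)) (shift q (p ^ m ∸ 1))
    where
    shift : ∀ q P → P + suc q * suc P ≡ suc q + P * suc (suc q)
    shift = solve-∀

  -- p^m - 1 has m digits, all equal to p - 1.
  σ[p^m∸1] : ∀ m → σ (p ^ m ∸ 1) ≡ m * suc q
  σ[p^m∸1] zero = refl
  σ[p^m∸1] (suc m) = begin
    σ (p ^ suc m ∸ 1)               ≡⟨ cong σ (p^[1+m]∸1 m) ⟩
    σ (suc q + (p ^ m ∸ 1) * p)      ≡⟨ σ-digit (suc q) (p ^ m ∸ 1) ≤-refl ⟩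
    suc q + σ (p ^ m ∸ 1)           ≡⟨ cong (_+_ (suc q)) (σ[p^m∸1] m) ⟩
    suc q + m * suc q               ∎
    where open ≡-Reasoning

  cofactor-returns : ∀ {u d c} m → u * d ≡ c * (p ^ m ∸ 1) → u * d + c ≡ c * p ^ m
  cofactor-returns {u} {d} {c} m ud≡cP = begin
    u * d + c                 ≡⟨ cong (_+ c) ud≡cP ⟩
    c * (p ^ m ∸ 1) + c       ≡⟨ rearrange c (p ^ m ∸ 1) ⟩
    c * suc (p ^ m ∸ 1)       ≡⟨ cong (c *_) (sym (p^m≡1+[p^m∸1] m)) ⟩
    c * p ^ m                 ∎
    where
    open ≡-Reasoning
    rearrange : ∀ c P → c * P + c ≡ c * suc P
    rearrange = solve-∀

  -- Orbits of residues modulo d under multiplication by p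

  module Residues (d : ℕ) .{{_ : NonZero d}} where

    r : ℕ → ℕ → ℕ
    r c i = c * p ^ i % d

    S : ℕ → ℕ → ℕ
    S c n = ∑ n (r c)

    -- Each of the n remainders is below d.
    S-≤ : ∀ c n → S c n ≤ n * d
    S-≤ c n = ∑-≤ (r c) n d (λ i → <⇒≤ (m%n<n (c * p ^ i) d))

    r-periodic : ∀ c {u} m → u * d + c ≡ c * p ^ m → ∀ i → r c (m + i) ≡ r c i
    r-periodic c {u} m returns i = begin
      c * p ^ (m + i) % d              ≡⟨ cong (_% d) c·p^[m+i] ⟩
      (c * p ^ i + u * p ^ i * d) % d  ≡⟨ [m+kn]%n≡m%n (c * p ^ i) (u * p ^ i) d ⟩
      c * p ^ i % d                    ∎
      where
      open ≡-Reasoning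
      expand : ∀ u d c x → (u * d + c) * x ≡ c * x + u * x * d
      expand = solve-∀
      c·p^[m+i] : c * p ^ (m + i) ≡ c * p ^ i + u * p ^ i * d
      c·p^[m+i] = begin
        c * p ^ (m + i)        ≡⟨ cong (c *_) (^-distribˡ-+-* p m i) ⟩
        c * (p ^ m * p ^ i)    ≡⟨ sym (*-assoc c _ _) ⟩
        c * p ^ m * p ^ i      ≡⟨ cong (_* p ^ i) (sym returns) ⟩
        (u * d + c) * p ^ i    ≡⟨ expand u d c (p ^ i) ⟩
        c * p ^ i + u * p ^ i * d ∎

    -- For two periods m and n of the orbit, n·S(c,m) and m·S(c,n) both equal S(c,mn).
    S-swap : ∀ c {u v} m n → u * d + c ≡ c * p ^ m → v * d + c ≡ c * p ^ n →
             n * S c m ≡ m * S c n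
    S-swap c {u} {v} m n returns-m returns-n = begin
      n * S c m        ≡⟨ sym (∑-periodic (r c) m (r-periodic c {u} m returns-m) n) ⟩
      ∑ (n * m) (r c)  ≡⟨ cong (λ k → ∑ k (r c)) (*-comm n m) ⟩
      ∑ (m * n) (r c)  ≡⟨ ∑-periodic (r c) n (r-periodic c {v} n returns-n) m ⟩
      m * S c n        ∎
      where open ≡-Reasoning

    -- Long division of c < d by d in base p: quot n = ⌊c p^n / d⌋ consists of the
    -- first n base-p digits of c/d, and r c n is the remainder after n steps.
    module LongDivision (c : ℕ) (c<d : c < d) where

      quot : ℕ → ℕ
      quot n = c * p ^ n / d

      digit : ℕ → ℕ
      digit n = quot (suc n) % p

      quot-shift : ∀ n → quot (suc n) / p ≡ quot n
      quot-shift n = begin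
        c * (p * p ^ n) / d / p     ≡⟨ m/n/o≡m/[n*o] _ d p ⟩
        c * (p * p ^ n) / (d * p)   ≡⟨ /-congʳ (*-comm d p) ⟩
        c * (p * p ^ n) / (p * d)   ≡⟨ cong (_/ (p * d)) (regroup c p (p ^ n)) ⟩
        p * (c * p ^ n) / (p * d)   ≡⟨ m*n/m*o≡n/o p (c * p ^ n) d ⟩
        c * p ^ n / d               ∎
        where
        open ≡-Reasoning
        instance _ = m*n≢0 d p
        instance _ = m*n≢0 p d
        regroup : ∀ c p x → c * (p * x) ≡ p * (c * x)
        regroup = solve-∀

      quot-step : ∀ n → quot (suc n) ≡ digit n + quot n * p
      quot-step n = trans (m≡m%n+[m/n]*n (quot (suc n)) p) (cong (λ x → digit n + x * p) (quot-shift n))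

      r-step : ∀ n → r c (suc n) + digit n * d ≡ p * r c n
      r-step n = +-cancelʳ-≡ (quot n * p * d) _ _ (begin
        r c (suc n) + digit n * d + quot n * p * d  ≡⟨ regroup₁ (r c (suc n)) (digit n) (quot n) p d ⟩
        r c (suc n) + (digit n + quot n * p) * d    ≡⟨ cong (λ x → r c (suc n) + x * d) (sym (quot-step n)) ⟩
        r c (suc n) + quot (suc n) * d              ≡⟨ sym (m≡m%n+[m/n]*n (c * p ^ suc n) d) ⟩
        c * (p * p ^ n)                             ≡⟨ regroup₂ c p (p ^ n) ⟩
        p * (c * p ^ n)                             ≡⟨ cong (p *_) (m≡m%n+[m/n]*n (c * p ^ n) d) ⟩
        p * (r c n + quot n * d)                    ≡⟨ regroup₃ p (r c n) (quot n) d ⟩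
        p * r c n + quot n * p * d                  ∎)
        where
        open ≡-Reasoning
        regroup₁ : ∀ r δ Q p d → r + δ * d + Q * p * d ≡ r + (δ + Q * p) * d
        regroup₁ = solve-∀
        regroup₂ : ∀ c p x → c * (p * x) ≡ p * (c * x)
        regroup₂ = solve-∀
        regroup₃ : ∀ p r Q d → p * (r + Q * d) ≡ p * r + Q * p * d
        regroup₃ = solve-∀

      invariant : ∀ n → σ (quot n) * d + r c n ≡ suc q * S c n + c
      invariant zero = begin
        σ (c * 1 / d) * d + c * 1 % d  ≡⟨ cong (λ x → σ (x / d) * d + x % d) (*-identityʳ c) ⟩
        σ (c / d) * d + c % d          ≡⟨ cong₂ (λ x y → σ x * d + y) (m<n⇒m/n≡0 c<d) (m<n⇒m%n≡m c<d) ⟩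
        c                              ≡⟨ cong (_+ c) (sym (*-zeroʳ (suc q))) ⟩
        suc q * 0 + c                  ∎
        where open ≡-Reasoning
      invariant (suc n) = begin
        σ (quot (suc n)) * d + r c (suc n)
          ≡⟨ cong (λ x → σ x * d + r c (suc n)) (quot-step n) ⟩
        σ (digit n + quot n * p) * d + r c (suc n)
          ≡⟨ cong (λ x → x * d + r c (suc n)) (σ-digit (digit n) (quot n) (m%n<n (quot (suc n)) p)) ⟩
        (digit n + σ (quot n)) * d + r c (suc n)
          ≡⟨ regroup₁ (digit n) (σ (quot n)) d (r c (suc n)) ⟩
        (r c (suc n) + digit n * d) + σ (quot n) * d
          ≡⟨ cong (_+ σ (quot n) * d) (r-step n) ⟩
        p * r c n + σ (quot n) * d
          ≡⟨ regroup₂ q (r c n) (σ (quot n) * d) ⟩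
        suc q * r c n + (σ (quot n) * d + r c n)
          ≡⟨ cong (_+_ (suc q * r c n)) (invariant n) ⟩
        suc q * r c n + (suc q * S c n + c)
          ≡⟨ regroup₃ q (r c n) (S c n) c ⟩
        suc q * (S c n + r c n) + c
          ∎
        where
        open ≡-Reasoning
        regroup₁ : ∀ δ s d r → (δ + s) * d + r ≡ (r + δ * d) + s * d
        regroup₁ = solve-∀
        regroup₂ : ∀ q r X → suc (suc q) * r + X ≡ suc q * r + (X + r)
        regroup₂ = solve-∀
        regroup₃ : ∀ q r S c → suc q * r + (suc q * S + c) ≡ suc q * (S + r) + c
        regroup₃ = solve-∀

    σ-quotient : ∀ {c u} m → c < d → u * d + c ≡ c * p ^ m → σ u * d ≡ suc q * S c m
    σ-quotient {c} {u} m c<d returns = +-cancelʳ-≡ c _ _ (begin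
      σ u * d + c             ≡⟨ cong₂ (λ x y → σ x * d + y) (sym quot≡u) (sym r≡c) ⟩
      σ (quot m) * d + r c m  ≡⟨ invariant m ⟩
      suc q * S c m + c       ∎)
      where
      open ≡-Reasoning
      open LongDivision c c<d
      quot≡u : quot m ≡ u
      quot≡u = begin
        c * p ^ m / d        ≡⟨ cong (_/ d) (sym returns) ⟩
        (u * d + c) / d      ≡⟨ +-distrib-/-∣ˡ c (divides u refl) ⟩
        u * d / d + c / d    ≡⟨ cong₂ _+_ (m*n/n≡m u d) (m<n⇒m/n≡0 c<d) ⟩
        u + 0                ≡⟨ +-identityʳ u ⟩
        u                    ∎
      r≡c : r c m ≡ c
      r≡c = begin
        c * p ^ m % d        ≡⟨ cong (_% d) (trans (sym returns) (+-comm (u * d) c)) ⟩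
        (c + u * d) % d      ≡⟨ [m+kn]%n≡m%n c u d ⟩
        c % d                ≡⟨ m<n⇒m%n≡m c<d ⟩
        c                    ∎

module Minimum (q d' l' k : ℕ) (period : suc (suc q) ^ suc l' ∸ 1 ≡ k * suc (suc d')) where

  open BaseExpansion q

  d ℓ : ℕ
  d = suc (suc d')
  ℓ = suc l'

  open Residues d

  returns-ℓ : ∀ c → (c * k) * d + c ≡ c * p ^ ℓ
  returns-ℓ c = cofactor-returns {c * k} {d} {c} ℓ (trans (*-assoc c k d) (cong (c *_) (sym period)))

  -- a⋆ minimises S(a,ℓ), i.e. τ_d(a), over 1 ≤ a ≤ d-1.
  -- (opaque: the proof only needs its specification, never the computed minimiser)
  opaque
    minimiser : ∃[ a ] ((1 ≤ a × a ≤ suc d') × (∀ b → 1 ≤ b → b ≤ suc d' → S a ℓ ≤ S b ℓ))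
    minimiser = argmin-interval (λ a → S a ℓ) (suc d') (s≤s z≤n)

  a⋆ : ℕ
  a⋆ = proj₁ minimiser

  a⋆-range : 1 ≤ a⋆ × a⋆ ≤ suc d'
  a⋆-range = proj₁ (proj₂ minimiser)

  a⋆-minimal : ∀ b → 1 ≤ b → b ≤ suc d' → S a⋆ ℓ ≤ S b ℓ
  a⋆-minimal = proj₂ (proj₂ minimiser)

  -- Bound m s: the cross-multiplied form of τ_d(a⋆) ≤ s/((p-1)m).
  Bound : ℕ → ℕ → Set
  Bound m s = S a⋆ ℓ * (suc q * m) ≤ s * (ℓ * d)

  -- The top element p^m - 1 (cofactor d): σ_p = m(p-1), and S(a⋆,ℓ) ≤ ℓd.
  bound-top : ∀ m → Bound m (σ (p ^ m ∸ 1))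
  bound-top m = begin
    S a⋆ ℓ * (suc q * m)       ≤⟨ *-monoˡ-≤ (suc q * m) (S-≤ a⋆ ℓ) ⟩
    ℓ * d * (suc q * m)        ≡⟨ regroup (ℓ * d) q m ⟩
    m * suc q * (ℓ * d)        ≡⟨ cong (_* (ℓ * d)) (sym (σ[p^m∸1] m)) ⟩
    σ (p ^ m ∸ 1) * (ℓ * d)    ∎
    where
    open ≤-Reasoning
    regroup : ∀ x q m → x * (suc q * m) ≡ m * suc q * x
    regroup = solve-∀

  -- A proper cofactor 1 ≤ c < d: d·σ_p(u) = (p-1)·S(c,m) and ℓ·S(c,m) = m·S(c,ℓ).
  bound-proper : ∀ {m u c} → 1 ≤ c → c < d → u * d + c ≡ c * p ^ m → Bound m (σ u)
  bound-proper {m} {u} {c} 1≤c c<d returns = begin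
    S a⋆ ℓ * (suc q * m)   ≤⟨ *-monoˡ-≤ (suc q * m) (a⋆-minimal c 1≤c (ℕ.≤-pred c<d)) ⟩
    S c ℓ * (suc q * m)    ≡⟨ regroup₁ (S c ℓ) q m ⟩
    suc q * (m * S c ℓ)    ≡⟨ cong (suc q *_) (sym (S-swap c {u} {c * k} m ℓ returns (returns-ℓ c))) ⟩
    suc q * (ℓ * S c m)    ≡⟨ regroup₂ q ℓ (S c m) ⟩
    ℓ * (suc q * S c m)    ≡⟨ cong (ℓ *_) (sym (σ-quotient {c} {u} m c<d returns)) ⟩
    ℓ * (σ u * d)          ≡⟨ regroup₃ ℓ (σ u) d ⟩
    σ u * (ℓ * d)          ∎
    where
    open ≤-Reasoning
    regroup₁ : ∀ s q m → s * (suc q * m) ≡ suc q * (m * s)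
    regroup₁ = solve-∀
    regroup₂ : ∀ q l s → suc q * (l * s) ≡ l * (suc q * s)
    regroup₂ = solve-∀
    regroup₃ : ∀ l s d → l * (s * d) ≡ s * (l * d)
    regroup₃ = solve-∀

  bound-cofactor : ∀ {m u c} → 1 ≤ c → c ≤ d → u * d ≡ c * (p ^ m ∸ 1) → Bound m (σ u)
  bound-cofactor {m} {u} {c} 1≤c c≤d ud≡cP = [ proper , top ]′ (m≤n⇒m<n∨m≡n c≤d)
    where
    proper : c < d → Bound m (σ u)
    proper c<d = bound-proper {m} {u} {c} 1≤c c<d (cofactor-returns {u} {d} {c} m ud≡cP)
    top : c ≡ d → Bound m (σ u)
    top c≡d = subst (λ x → Bound m (σ x)) (sym u≡P) (bound-top m)
      where
      u≡P : u ≡ p ^ m ∸ 1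
      u≡P = *-cancelʳ-≡ u (p ^ m ∸ 1) d
        (trans ud≡cP (trans (cong (_* (p ^ m ∸ 1)) c≡d) (*-comm d (p ^ m ∸ 1))))

  bound-E : ∀ {m u} → u ∈ E p d m → Bound m (σ u)
  bound-E {m} {u} u∈E =
    let c , (1≤c , c≤d) , ud≡cP = E-cofactor {p} {d} {m} u∈E
    in bound-cofactor {m} {u} {c} 1≤c c≤d ud≡cP

  bound-σ-D : ∀ m → Bound m (σ-D p d m)
  bound-σ-D m = min-fold-all (Bound m) σ (σ (p ^ m ∸ 1)) (E p d m) (bound-top m) bound-E

  -- For m = ℓ the bound is attained at u⋆ = a⋆(p^ℓ - 1)/d = a⋆k ∈ E_D(ℓ).
  attained : σ-D p d ℓ * (ℓ * d) ≤ S a⋆ ℓ * (suc q * ℓ)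
  attained = begin
    σ-D p d ℓ * (ℓ * d)       ≤⟨ *-monoˡ-≤ (ℓ * d) (min-fold-≤ σ (σ (p ^ ℓ ∸ 1)) (E p d ℓ) u⋆∈E) ⟩
    σ (a⋆ * k) * (ℓ * d)      ≡⟨ regroup₁ (σ (a⋆ * k)) ℓ d ⟩
    ℓ * (σ (a⋆ * k) * d)      ≡⟨ cong (ℓ *_) (σ-quotient {a⋆} {a⋆ * k} ℓ (s≤s (proj₂ a⋆-range)) (returns-ℓ a⋆)) ⟩
    ℓ * (suc q * S a⋆ ℓ)      ≡⟨ regroup₂ ℓ q (S a⋆ ℓ) ⟩
    S a⋆ ℓ * (suc q * ℓ)      ∎
    where
    open ≤-Reasoning
    regroup₁ : ∀ s l d → s * (l * d) ≡ l * (s * d)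
    regroup₁ = solve-∀
    regroup₂ : ∀ l q s → l * (suc q * s) ≡ s * (suc q * l)
    regroup₂ = solve-∀
    factor-positive : ∀ x y → 1 ≤ x * y → 1 ≤ x
    factor-positive (suc _) y _ = s≤s z≤n
    1≤k : 1 ≤ k
    1≤k = factor-positive k d (subst (1 ≤_) (trans (sym (p^[1+m]∸1 l')) period) (s≤s z≤n))
    u⋆∈E : a⋆ * k ∈ E p d ℓ
    u⋆∈E = E-intro {p} {d} {ℓ} (*-mono-≤ (proj₁ a⋆-range) 1≤k)
      (subst (a⋆ * k ≤_) (trans (*-comm d k) (sym period)) (*-monoˡ-≤ k (m≤n⇒m≤1+n (proj₂ a⋆-range))))
      (divides a⋆ (trans (*-assoc a⋆ k d) (cong (a⋆ *_) (sym period))))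

  Σ<-frac : ∀ a n → Σ< n (λ i → ⟨ (a * p ^ i) // d ⟩) ≡ S a n // d
  Σ<-frac a zero = //-cong 0 0 0 (suc d') refl
  Σ<-frac a (suc n) = trans (cong₂ ℚ._+_ (Σ<-frac a n) (frac-// (a * p ^ n) (suc d')))
    (//-+ (S a n) (r a n) (suc d'))

  τ≡ : ∀ a → τ p d ℓ a ≡ S a ℓ // (ℓ * d)
  τ≡ a = trans (cong ((1 // ℓ) ℚ.*_) (Σ<-frac a ℓ)) (//-*-inverse (S a ℓ) l' (suc d'))

  π-term≡ : ∀ m → (1 // (p ∸ 1)) ℚ.* (σ-D p d (suc m) // suc m) ≡ σ-D p d (suc m) // (suc q * suc m)
  π-term≡ m = //-*-inverse (σ-D p d (suc m)) q m

  τ⋆-minimal : ∀ b → 1 ≤ b × b ≤ d ∸ 1 → τ p d ℓ a⋆ ℚ.≤ τ p d ℓ b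
  τ⋆-minimal b (1≤b , b≤d-1) = begin
    τ p d ℓ a⋆           ≡⟨ τ≡ a⋆ ⟩
    S a⋆ ℓ // (ℓ * d)    ≤⟨ //-mono-≤ (S a⋆ ℓ) (S b ℓ) (ℕ.pred (ℓ * d)) (ℕ.pred (ℓ * d))
                              (*-monoˡ-≤ (ℓ * d) (a⋆-minimal b 1≤b b≤d-1)) ⟩
    S b ℓ // (ℓ * d)     ≡⟨ sym (τ≡ b) ⟩
    τ p d ℓ b            ∎
    where open ℚP.≤-Reasoning

  π-term-attained : (1 // (p ∸ 1)) ℚ.* (σ-D p d ℓ // ℓ) ≡ τ p d ℓ a⋆
  π-term-attained = begin
    (1 // (p ∸ 1)) ℚ.* (σ-D p d ℓ // ℓ)  ≡⟨ π-term≡ l' ⟩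
    σ-D p d ℓ // (suc q * ℓ)            ≡⟨ //-cong (σ-D p d ℓ) (S a⋆ ℓ) (ℕ.pred (suc q * ℓ)) (ℕ.pred (ℓ * d))
                                              (≤-antisym attained (bound-σ-D ℓ)) ⟩
    S a⋆ ℓ // (ℓ * d)                   ≡⟨ sym (τ≡ a⋆) ⟩
    τ p d ℓ a⋆                          ∎
    where open ≡-Reasoning

  π-term-bounded : ∀ m → 1 ≤ m → τ p d ℓ a⋆ ℚ.≤ (1 // (p ∸ 1)) ℚ.* (σ-D p d m // m)
  π-term-bounded (suc m) _ = begin
    τ p d ℓ a⋆                              ≡⟨ τ≡ a⋆ ⟩
    S a⋆ ℓ // (ℓ * d)                       ≤⟨ //-mono-≤ (S a⋆ ℓ) (σ-D p d (suc m)) (ℕ.pred (ℓ * d))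
                                                  (ℕ.pred (suc q * suc m)) (bound-σ-D (suc m)) ⟩
    σ-D p d (suc m) // (suc q * suc m)      ≡⟨ sym (π-term≡ m) ⟩
    (1 // (p ∸ 1)) ℚ.* (σ-D p d (suc m) // suc m) ∎
    where open ℚP.≤-Reasoning

  π≡minτ : ∃[ v ] (IsπD p d v × IsMinτ p d ℓ v)
  π≡minτ = τ p d ℓ a⋆
    , ((ℓ , s≤s z≤n , π-term-attained) , π-term-bounded)
    , ((a⋆ , a⋆-range , refl) , τ⋆-minimal)

prime⇒1<p : ∀ {p} → Prime p → 1 < p
prime⇒1<p p-prime = nonTrivial⇒n>1 _ {{prime⇒nonTrivial p-prime}}

mainTheorem6 : (p d ℓ : ℕ) → Prime p → 1 < d → Coprime p d → IsOrder p d ℓ →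
    ∃[ v ] (IsπD p d v × IsMinτ p d ℓ v)
mainTheorem6 zero _ _ p-prime _ _ _ with () ← prime⇒1<p p-prime
mainTheorem6 (suc zero) _ _ p-prime _ _ _ with s≤s () ← prime⇒1<p p-prime
mainTheorem6 (suc (suc q)) (suc (suc d')) (suc l') _ (s≤s (s≤s z≤n)) _ (s≤s z≤n , divides k period , _) =
  Minimum.π≡minτ q d' l' k period
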